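{- Let $n, k$ be positive integers. In either the fixed-threshold adaptive model or the adjustable-threshold adaptive model, any (deterministic) algorithm that correctly computes $MAJ_n(x)$ for every $x \in \{0,1\}^n$ must, on some input $x$, make at least $\lceil n/k \rceil$ queries to the oracle.
   Context: For $x\in\{0,1\}^n$, $MAJ_n(x) = [x_1+\cdots+x_n \ge n/2]$, where $[P]=1$ if $P$ holds and $0$ otherwise. For $S\subseteq\{1,\ldots,n\}$ let $sum_S(x)=\sum_{i\in S}x_i$, $MAJ_S(x) = [sum_S(x) \ge |S|/2]$ and $MAJ_S(x;t) = [sum_S(x)\ge t]$. In the adaptive models an algorithm has access to an oracle that knows the hidden vector $x$. In the adjustable-threshold adaptive model, a query is a pair $(S,t)$ with $S\subseteq\{1,\ldots,n\}$, $|S|\le k$, $t$ an integer, and the oracle answers $MAJ_S(x;t)$. In the fixed-threshold adaptive model, a query is a set $S\subseteq\{1,\ldots,n\}$ with $|S|\le k$, and the oracle answers $MAJ_S(x)$. The cost of an algorithm is the worst-case number of queries. -}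

module Defs where

open import Data.Bool using (Bool; true; false; if_then_else_)
open import Data.Nat using (ℕ; zero; suc; _+_; _*_; _≤_; _≤?_; _/_)
open import Data.Integer using (ℤ; +_) renaming (_≤?_ to _≤ℤ?_)
open import Data.Vec using (Vec; []; _∷_)
open import Data.Fin.Subset using (Subset; ∣_∣)
open import Data.Product using (_×_; _,_)
open import Relation.Nullary.Decidable using (⌊_⌋)

-- Hidden input x ∈ {0,1}^n is a Vec Bool n (true = 1).
-- A query set S ⊆ {1..n} is a Subset n (characteristic vector).

bit : Bool → ℕ
bit true  = 1
bit false = 0

sumS : ∀ {n} → Subset n → Vec Bool n → ℕ
sumS []       []       = 0
sumS (s ∷ S) (b ∷ x) = (if s then bit b else 0) + sumS S x

total : ∀ {n} → Vec Bool n → ℕ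
total []      = 0
total (b ∷ x) = bit b + total x

-- MAJ_n(x) = [x_1+...+x_n ≥ n/2]   (equivalently n ≤ 2·sum)
MAJ : ∀ {n} → Vec Bool n → Bool
MAJ {n} x = ⌊ n ≤? 2 * total x ⌋

MAJS : ∀ {n} → Subset n → Vec Bool n → Bool
MAJS S x = ⌊ ∣ S ∣ ≤? 2 * sumS S x ⌋

MAJSt : ∀ {n} → Subset n → ℤ → Vec Bool n → Bool
MAJSt S t x = ⌊ t ≤ℤ? + (sumS S x) ⌋

-- Deterministic adaptive algorithms = binary decision trees over a query type Q.
-- node q f t : ask q; continue with f if the answer is 0 (false), t if 1 (true).
data DTree (Q : Set) : Set where
  leaf : Bool → DTree Q
  node : Q → DTree Q → DTree Q → DTree Q

run : ∀ {Q} → (Q → Bool) → DTree Q → Bool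
run ans (leaf b)     = b
run ans (node q f t) = if ans q then run ans t else run ans f

cost : ∀ {Q} → (Q → Bool) → DTree Q → ℕ
cost ans (leaf b)     = 0
cost ans (node q f t) = suc (if ans q then cost ans t else cost ans f)

data AllQ {Q : Set} (P : Q → Set) : DTree Q → Set where
  leaf : ∀ {b} → AllQ P (leaf b)
  node : ∀ {q f t} → P q → AllQ P f → AllQ P t → AllQ P (node q f t)

FixedQ : ℕ → Set
FixedQ n = Subset n

fixedAns : ∀ {n} → Vec Bool n → FixedQ n → Bool
fixedAns x S = MAJS S x

fixedValid : ∀ {n} → ℕ → FixedQ n → Set
fixedValid k S = ∣ S ∣ ≤ k

AdjQ : ℕ → Set
AdjQ n = Subset n × ℤ

adjAns : ∀ {n} → Vec Bool n → AdjQ n → Bool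
adjAns x (S , t) = MAJSt S t x

adjValid : ∀ {n} → ℕ → AdjQ n → Set
adjValid k (S , t) = ∣ S ∣ ≤ k

-- ⌈ n / k ⌉ for k ≥ 1 (value at k = 0 is irrelevant: k ≥ 1 is assumed)
ceilDiv : ℕ → ℕ → ℕ
ceilDiv n zero    = 0
ceilDiv n (suc k) = (n + k) / suc k

module Submission where

-- Both query models are instances of one "sum query" model: a query q has a
-- support set of size at most k, and its answer on x depends only on the
-- sum of x over that support.  For any such model we run an adversary.  It
-- keeps a partial assignment ρ (a cell is free or fixed to a bit) and fixes
-- every free variable of a query's support, alternating 0,1,0,1,... across
-- the whole run.  The alternation is captured by the invariant
--     bit p + potential ρ ≡ n,
-- where a free cell weighs 1, a 0 weighs 0, a 1 weighs 2, and p is the next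
-- value to be handed out.  After a query every extension of ρ gets the same
-- answer, so the algorithm cannot tell them apart; a query fixes at most k
-- cells.  If a free cell remains when the algorithm stops, completing ρ by
-- all 1s and by all 0s gives inputs with different majority (by the
-- invariant), contradicting correctness.  Hence the adversary's path fixes
-- all n cells, i.e. n ≤ cost · k, and ⌈n/k⌉ ≤ cost follows.

open import Defs
open import Data.Bool using (Bool; true; false; not; if_then_else_)
open import Data.Nat using (ℕ; zero; suc; _+_; _*_; _≤_; _<_; _≤?_; z≤n; s≤s; s≤s⁻¹)
open import Data.Nat.Properties
open import Data.Nat.DivMod using (m<n*o⇒m/o<n)
open import Data.Nat.Tactic.RingSolver using (solve-∀)
import Data.Integer as Int
open import Data.Maybe using (Maybe; just; nothing; fromMaybe)
open import Data.Vec using (Vec; []; _∷_; map; sum; replicate)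
open import Data.Vec.Relation.Binary.Pointwise.Inductive using (Pointwise; []; _∷_)
open import Data.Fin.Subset using (Subset; ∣_∣)
open import Data.Product using (Σ; _×_; _,_; proj₁; proj₂)
open import Data.Unit using (⊤; tt)
open import Relation.Nullary using (¬_; yes; no; contradiction)
open import Relation.Nullary.Decidable using (⌊_⌋)
open import Relation.Binary.PropositionalEquality

-- A cell of a partial assignment: `nothing` is free, `just b` is fixed to b.
Partial : ℕ → Set
Partial n = Vec (Maybe Bool) n

Compatible : Maybe Bool → Bool → Set
Compatible nothing  b = ⊤
Compatible (just c) b = c ≡ b

Extends : ∀ {n} → Partial n → Vec Bool n → Set
Extends = Pointwise Compatible

complete : ∀ {n} → Bool → Partial n → Vec Bool n
complete b = map (fromMaybe b)

complete-extends : ∀ {n} b (ρ : Partial n) → Extends ρ (complete b ρ)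
complete-extends b []            = []
complete-extends b (nothing ∷ ρ) = tt ∷ complete-extends b ρ
complete-extends b (just c ∷ ρ)  = refl ∷ complete-extends b ρ

freeCell : Maybe Bool → ℕ
freeCell nothing  = 1
freeCell (just _) = 0

free : ∀ {n} → Partial n → ℕ
free ρ = sum (map freeCell ρ)

-- Weight of a cell: free = 1, fixed 0 = 0, fixed 1 = 2.  It equals twice
-- the average of the cell's two possible bits.
weight : Maybe Bool → ℕ
weight nothing      = 1
weight (just false) = 0
weight (just true)  = 2

potential : ∀ {n} → Partial n → ℕ
potential ρ = sum (map weight ρ)

swap : ∀ a b c → a + (b + c) ≡ b + (a + c)
swap = solve-∀

regroup : ∀ a b c d → 2 * (a + b) + (c + d) ≡ (2 * a + c) + (2 * b + d)
regroup = solve-∀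

double-total-zeros : ∀ {n} (ρ : Partial n) → 2 * total (complete false ρ) + free ρ ≡ potential ρ
double-total-zeros []       = refl
double-total-zeros (m ∷ ρ) = begin
  2 * (bit (fromMaybe false m) + total (complete false ρ)) + (freeCell m + free ρ)
    ≡⟨ regroup (bit (fromMaybe false m)) _ (freeCell m) _ ⟩
  (2 * bit (fromMaybe false m) + freeCell m) + (2 * total (complete false ρ) + free ρ)
    ≡⟨ cong₂ _+_ (cell m) (double-total-zeros ρ) ⟩
  weight m + potential ρ ∎
  where
  open ≡-Reasoning
  cell : ∀ m → 2 * bit (fromMaybe false m) + freeCell m ≡ weight m
  cell nothing      = refl
  cell (just false) = refl
  cell (just true)  = refl

double-total-ones : ∀ {n} (ρ : Partial n) → 2 * total (complete true ρ) ≡ potential ρ + free ρ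
double-total-ones []       = refl
double-total-ones (m ∷ ρ) = begin
  2 * (bit (fromMaybe true m) + total (complete true ρ))
    ≡⟨ *-distribˡ-+ 2 (bit (fromMaybe true m)) _ ⟩
  2 * bit (fromMaybe true m) + 2 * total (complete true ρ)
    ≡⟨ cong₂ _+_ (cell m) (double-total-ones ρ) ⟩
  (weight m + freeCell m) + (potential ρ + free ρ)
    ≡⟨ +-assoc (weight m) _ _ ⟩
  weight m + (freeCell m + (potential ρ + free ρ))
    ≡⟨ cong (weight m +_) (swap (freeCell m) (potential ρ) (free ρ)) ⟩
  weight m + (potential ρ + (freeCell m + free ρ))
    ≡⟨ +-assoc (weight m) _ _ ⟨
  (weight m + potential ρ) + (freeCell m + free ρ) ∎
  where
  open ≡-Reasoning
  cell : ∀ m → 2 * bit (fromMaybe true m) ≡ weight m + freeCell m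
  cell nothing      = refl
  cell (just false) = refl
  cell (just true)  = refl

majority-true : ∀ {n} (x : Vec Bool n) → n ≤ 2 * total x → MAJ x ≡ true
majority-true {n} x h with n ≤? 2 * total x
... | yes _ = refl
... | no ¬h = contradiction h ¬h

majority-false : ∀ {n} (x : Vec Bool n) → 2 * total x < n → MAJ x ≡ false
majority-false {n} x h with n ≤? 2 * total x
... | yes n≤ = contradiction n≤ (<⇒≱ h)
... | no _ = refl

undecided : ∀ {n} p (ρ : Partial n) → bit p + potential ρ ≡ n → 1 ≤ free ρ →
  MAJ (complete true ρ) ≡ true × MAJ (complete false ρ) ≡ false
undecided {n} p ρ inv hasFree =
  majority-true (complete true ρ) above , majority-false (complete false ρ) below
  where
  bit≤1 : ∀ p → bit p ≤ 1
  bit≤1 true  = s≤s z≤n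
  bit≤1 false = z≤n
  above : n ≤ 2 * total (complete true ρ)
  above = begin
    n                          ≡⟨ inv ⟨
    bit p + potential ρ        ≤⟨ +-monoˡ-≤ (potential ρ) (≤-trans (bit≤1 p) hasFree) ⟩
    free ρ + potential ρ       ≡⟨ +-comm (free ρ) _ ⟩
    potential ρ + free ρ       ≡⟨ double-total-ones ρ ⟨
    2 * total (complete true ρ) ∎
    where open ≤-Reasoning
  below : 2 * total (complete false ρ) < n
  below = begin-strict
    2 * total (complete false ρ)          <⟨ m<m+n _ hasFree ⟩
    2 * total (complete false ρ) + free ρ ≡⟨ double-total-zeros ρ ⟩
    potential ρ                           ≤⟨ m≤n+m _ (bit p) ⟩
    bit p + potential ρ                   ≡⟨ inv ⟩
    n ∎
    where open ≤-Reasoning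

fill : ∀ {n} → Bool → Subset n → Partial n → Partial n
fill p []          []            = []
fill p (true ∷ S)  (nothing ∷ ρ) = just p ∷ fill (not p) S ρ
fill p (true ∷ S)  (just c ∷ ρ)  = just c ∷ fill p S ρ
fill p (false ∷ S) (m ∷ ρ)       = m ∷ fill p S ρ

next : ∀ {n} → Bool → Subset n → Partial n → Bool
next p []          []            = p
next p (true ∷ S)  (nothing ∷ ρ) = next (not p) S ρ
next p (true ∷ S)  (just c ∷ ρ)  = next p S ρ
next p (false ∷ S) (m ∷ ρ)       = next p S ρ

untouched-cell : ∀ w a b c d → a + b ≡ c + d → a + (w + b) ≡ c + (w + d)
untouched-cell w a b c d eq = begin
  a + (w + b) ≡⟨ swap a w b ⟩
  w + (a + b) ≡⟨ cong (w +_) eq ⟩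
  w + (c + d) ≡⟨ swap w c d ⟩
  c + (w + d) ∎
  where open ≡-Reasoning

-- Alternation preserves the invariant: handing out p turns a weight-1 free
-- cell into a weight-2·bit p cell, and bit p + 1 ≡ 2·bit p + bit (not p).
potential-fill : ∀ {n} p (S : Subset n) (ρ : Partial n) →
  bit (next p S ρ) + potential (fill p S ρ) ≡ bit p + potential ρ
potential-fill p     []          []            = refl
potential-fill false (true ∷ S)  (nothing ∷ ρ) = potential-fill true S ρ
potential-fill true  (true ∷ S)  (nothing ∷ ρ) = begin
  bit (next false S ρ) + (2 + potential (fill false S ρ))
    ≡⟨ swap (bit (next false S ρ)) 2 _ ⟩
  2 + (bit (next false S ρ) + potential (fill false S ρ))
    ≡⟨ cong (2 +_) (potential-fill false S ρ) ⟩
  2 + potential ρ ∎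
  where open ≡-Reasoning
potential-fill p     (true ∷ S)  (just c ∷ ρ)  =
  untouched-cell (weight (just c)) (bit (next p S ρ)) _ (bit p) _ (potential-fill p S ρ)
potential-fill p     (false ∷ S) (m ∷ ρ)       =
  untouched-cell (weight m) (bit (next p S ρ)) _ (bit p) _ (potential-fill p S ρ)

free-fill : ∀ {n} p (S : Subset n) (ρ : Partial n) → free ρ ≤ ∣ S ∣ + free (fill p S ρ)
free-fill p []          []            = z≤n
free-fill p (true ∷ S)  (nothing ∷ ρ) = s≤s (free-fill (not p) S ρ)
free-fill p (true ∷ S)  (just c ∷ ρ)  = m≤n⇒m≤1+n (free-fill p S ρ)
free-fill p (false ∷ S) (m ∷ ρ)       =
  ≤-trans (+-monoʳ-≤ (freeCell m) (free-fill p S ρ)) (≤-reflexive (swap (freeCell m) ∣ S ∣ _))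

fill-extends : ∀ {n} p (S : Subset n) (ρ : Partial n) {x} → Extends (fill p S ρ) x → Extends ρ x
fill-extends p []          []            []       = []
fill-extends p (true ∷ S)  (nothing ∷ ρ) (_ ∷ e)  = tt ∷ fill-extends (not p) S ρ e
fill-extends p (true ∷ S)  (just c ∷ ρ)  (c≡ ∷ e) = c≡ ∷ fill-extends p S ρ e
fill-extends p (false ∷ S) (nothing ∷ ρ) (_ ∷ e)  = tt ∷ fill-extends p S ρ e
fill-extends p (false ∷ S) (just c ∷ ρ)  (c≡ ∷ e) = c≡ ∷ fill-extends p S ρ e

fill-determines-sum : ∀ {n} p (S : Subset n) (ρ : Partial n) {x y} →
  Extends (fill p S ρ) x → Extends (fill p S ρ) y → sumS S x ≡ sumS S y
fill-determines-sum p []          []            []        []        = refl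
fill-determines-sum p (true ∷ S)  (nothing ∷ ρ) (p≡ ∷ ex) (p≡′ ∷ ey) =
  cong₂ (λ b s → bit b + s) (trans (sym p≡) p≡′) (fill-determines-sum (not p) S ρ ex ey)
fill-determines-sum p (true ∷ S)  (just c ∷ ρ)  (c≡ ∷ ex) (c≡′ ∷ ey) =
  cong₂ (λ b s → bit b + s) (trans (sym c≡) c≡′) (fill-determines-sum p S ρ ex ey)
fill-determines-sum p (false ∷ S) (m ∷ ρ)       (_ ∷ ex)  (_ ∷ ey)  = fill-determines-sum p S ρ ex ey

unconstrained : ∀ n → Partial n
unconstrained n = replicate n nothing

free-unconstrained : ∀ n → free (unconstrained n) ≡ n
free-unconstrained zero    = refl
free-unconstrained (suc n) = cong suc (free-unconstrained n)

potential-unconstrained : ∀ n → potential (unconstrained n) ≡ n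
potential-unconstrained zero    = refl
potential-unconstrained (suc n) = cong suc (potential-unconstrained n)

ceilDiv-least : ∀ {n k c} → 1 ≤ k → n ≤ c * k → ceilDiv n k ≤ c
ceilDiv-least {n} {suc k} {c} _ n≤ck = s≤s⁻¹ (m<n*o⇒m/o<n (s≤s (begin
  n + k         ≡⟨ +-comm n k ⟩
  k + n         ≤⟨ +-monoʳ-≤ k n≤ck ⟩
  k + c * suc k ∎)))
  where open ≤-Reasoning

branch : ∀ {Q} → Bool → DTree Q → DTree Q → DTree Q
branch c f t = if c then t else f

run-node : ∀ {Q} (ans : Q → Bool) q f t → run ans (node q f t) ≡ run ans (branch (ans q) f t)
run-node ans q f t with ans q
... | true  = refl
... | false = refl

cost-node : ∀ {Q} (ans : Q → Bool) q f t → cost ans (node q f t) ≡ suc (cost ans (branch (ans q) f t))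
cost-node ans q f t with ans q
... | true  = refl
... | false = refl

allQ-branch : ∀ {Q} {P : Q → Set} {q f t} → AllQ P (node q f t) → ∀ c → AllQ P (branch c f t)
allQ-branch (node _ _ pt) true  = pt
allQ-branch (node _ pf _) false = pf

module SumQueries {Q : Set} {n : ℕ} (k : ℕ) (support : Q → Subset n) (decide : Q → ℕ → Bool) where

  answer : Vec Bool n → Q → Bool
  answer x q = decide q (sumS (support q) x)

  Small : Q → Set
  Small q = ∣ support q ∣ ≤ k

  CorrectOn : Partial n → DTree Q → Set
  CorrectOn ρ T = ∀ x → Extends ρ x → run (answer x) T ≡ MAJ x

  -- A leaf answers the same on all inputs, so it cannot be correct while a
  -- free cell lets the majority go either way.
  leaf-incorrect : ∀ {b p ρ} → bit p + potential ρ ≡ n → 1 ≤ free ρ → ¬ CorrectOn ρ (leaf b)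
  leaf-incorrect {b} {p} {ρ} inv hasFree correct with undecided p ρ inv hasFree
  ... | maj1 , maj0 with (begin
      true                      ≡⟨ maj1 ⟨
      MAJ (complete true ρ)     ≡⟨ correct (complete true ρ) (complete-extends true ρ) ⟨
      b                         ≡⟨ correct (complete false ρ) (complete-extends false ρ) ⟩
      MAJ (complete false ρ)    ≡⟨ maj0 ⟩
      false                     ∎)
    where open ≡-Reasoning
  ...   | ()

  adversary : (T : DTree Q) → AllQ Small T → (p : Bool) (ρ : Partial n) →
    bit p + potential ρ ≡ n → CorrectOn ρ T →
    Σ (Vec Bool n) λ x → Extends ρ x × free ρ ≤ cost (answer x) T * k
  adversary (leaf b) _ p ρ inv correct with 1 ≤? free ρ
  ... | no noFree   = complete false ρ , complete-extends false ρ , s≤s⁻¹ (≰⇒> noFree)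
  ... | yes hasFree = contradiction correct (leaf-incorrect inv hasFree)
  adversary (node q f t) small p ρ inv correct =
    lift (recurse c (allQ-branch small c) correct′)
    where
    S = support q
    ρ′ = fill p S ρ
    c = answer (complete false ρ′) q
    sub = branch c f t

    answer-fixed : ∀ x → Extends ρ′ x → answer x q ≡ c
    answer-fixed x e = cong (decide q) (fill-determines-sum p S ρ e (complete-extends false ρ′))

    correct′ : CorrectOn ρ′ sub
    correct′ x e = begin
      run (answer x) sub                       ≡⟨ cong (λ a → run (answer x) (branch a f t)) (answer-fixed x e) ⟨
      run (answer x) (branch (answer x q) f t) ≡⟨ run-node (answer x) q f t ⟨
      run (answer x) (node q f t)              ≡⟨ correct x (fill-extends p S ρ e) ⟩
      MAJ x                                    ∎
      where open ≡-Reasoning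

    recurse : ∀ b → AllQ Small (branch b f t) → CorrectOn ρ′ (branch b f t) →
      Σ (Vec Bool n) λ x → Extends ρ′ x × free ρ′ ≤ cost (answer x) (branch b f t) * k
    recurse true  small′ = adversary t small′ (next p S ρ) ρ′ (trans (potential-fill p S ρ) inv)
    recurse false small′ = adversary f small′ (next p S ρ) ρ′ (trans (potential-fill p S ρ) inv)

    lift : Σ (Vec Bool n) (λ x → Extends ρ′ x × free ρ′ ≤ cost (answer x) sub * k) →
           Σ (Vec Bool n) (λ x → Extends ρ x × free ρ ≤ cost (answer x) (node q f t) * k)
    lift (x , e , bound) = x , fill-extends p S ρ e , (begin
      free ρ                                              ≤⟨ free-fill p S ρ ⟩
      ∣ S ∣ + free ρ′                                     ≤⟨ +-mono-≤ (small-root small) bound ⟩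
      k + cost (answer x) sub * k                         ≡⟨ cong (λ a → suc (cost (answer x) (branch a f t)) * k) (answer-fixed x e) ⟨
      suc (cost (answer x) (branch (answer x q) f t)) * k ≡⟨ cong (_* k) (cost-node (answer x) q f t) ⟨
      cost (answer x) (node q f t) * k                    ∎)
      where
      open ≤-Reasoning
      small-root : AllQ Small (node q f t) → Small q
      small-root (node sq _ _) = sq

  lower-bound : 1 ≤ k → (T : DTree Q) → AllQ Small T → (∀ x → run (answer x) T ≡ MAJ x) →
    Σ (Vec Bool n) λ x → ceilDiv n k ≤ cost (answer x) T
  lower-bound k≥1 T small correct with adversary T small false (unconstrained n)
                                        (potential-unconstrained n) (λ x _ → correct x)
  ... | x , _ , bound = x , ceilDiv-least k≥1 (subst (_≤ cost (answer x) T * k) (free-unconstrained n) bound)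

mainTheorem2 : (n k : ℕ) → 1 ≤ n → 1 ≤ k →
    ((T : DTree (FixedQ n)) → AllQ (fixedValid k) T →
      ((x : Vec Bool n) → run (fixedAns x) T ≡ MAJ x) →
      Σ (Vec Bool n) (λ x → ceilDiv n k ≤ cost (fixedAns x) T))
    ×
    ((T : DTree (AdjQ n)) → AllQ (adjValid k) T →
      ((x : Vec Bool n) → run (adjAns x) T ≡ MAJ x) →
      Σ (Vec Bool n) (λ x → ceilDiv n k ≤ cost (adjAns x) T))
mainTheorem2 n k _ k≥1 =
    SumQueries.lower-bound k (λ S → S) (λ S s → ⌊ ∣ S ∣ ≤? 2 * s ⌋) k≥1
  , SumQueries.lower-bound k proj₁ (λ q s → ⌊ proj₂ q Int.≤? Int.+ s ⌋) k≥1
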